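{- Let $n\ge 1$, $d=\binom n2$, and let $(\gamma_0,\dots,\gamma_{\lfloor d/2\rfloor})$ be the $\gamma$-vector of $[n]!$. Then for each $i$, $$\gamma_i=(-1)^i\left|\bigcup_{j_1+j_2+\cdots+j_{n-1}=i}T(1,j_1)\times T(2,j_2)\times\cdots\times T(n-1,j_{n-1})\right|,$$ i.e. $(-1)^i\gamma_i$ is the number of $(n-1)$-tuples $(M_1,\dots,M_{n-1})$, where $M_m$ is a matching of the path graph on $m$ vertices, having $i$ edges in total.
   Context: $[m]=1+q+\cdots+q^{m-1}$, $[n]!=[n]\cdots[1]$, palindromic of palindromic degree $d=\binom n2$ (i.e. $q^d[n]!(1/q)=[n]!(q)$). The $\gamma$-vector of a palindromic polynomial $h$ of palindromic degree $d$ is the unique $(\gamma_0,\dots,\gamma_{\lfloor d/2\rfloor})$ with $h(q)=\sum_{0\le 2i\le d}\gamma_iq^i(1+q)^{d-2i}$. $T(m,j)$ is the set of matchings (sets of pairwise disjoint edges) with exactly $j$ edges in the path graph on $m$ vertices. For $n=1$ the tuple is empty, and the union consists of the single empty tuple when $i=0$. -}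

module Defs where

open import Data.Nat as ℕ using (ℕ; zero; suc; _∸_; _≡ᵇ_; ⌊_/2⌋)
open import Data.Nat.Combinatorics using (_C_)
open import Data.Integer as ℤ using (ℤ; +_; -_)
open import Data.Bool using (Bool; true; false; _∧_; not; if_then_else_)
open import Data.List as List using (List; []; _∷_; map; concatMap; filter; length; replicate)
open import Data.Nat.ListAction using (sum)
open import Data.Vec as Vec using (Vec)
open import Data.Fin using (Fin; toℕ)
open import Relation.Binary.PropositionalEquality using (_≡_)
open import Relation.Nullary.Decidable using (does)

-- Integer polynomials as coefficient lists (constant term first).

Poly : Set
Poly = List ℤ

coeff : Poly → ℕ → ℤ
coeff []       _       = + 0
coeff (a ∷ p)  zero    = a
coeff (a ∷ p)  (suc k) = coeff p k

_⊕_ : Poly → Poly → Poly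
[]      ⊕ q       = q
p       ⊕ []      = p
(a ∷ p) ⊕ (b ∷ q) = (a ℤ.+ b) ∷ (p ⊕ q)

scale : ℤ → Poly → Poly
scale c = map (c ℤ.*_)

_⊗_ : Poly → Poly → Poly
[]      ⊗ q = []
(a ∷ p) ⊗ q = scale a q ⊕ (+ 0 ∷ (p ⊗ q))

one : Poly
one = + 1 ∷ []

qPow : ℕ → Poly
qPow k = replicate k (+ 0) List.++ one

_^ᴾ_ : Poly → ℕ → Poly
p ^ᴾ zero  = one
p ^ᴾ suc k = p ⊗ (p ^ᴾ k)

onePlusQ : Poly
onePlusQ = + 1 ∷ + 1 ∷ []

qInt : ℕ → Poly
qInt m = replicate m (+ 1)

qFact : ℕ → Poly
qFact zero    = one
qFact (suc n) = qInt (suc n) ⊗ qFact n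

gammaExpansion : (d : ℕ) → Vec ℤ (suc ⌊ d /2⌋) → Poly
gammaExpansion d γ =
  List.foldr _⊕_ []
    (List.map (λ (i : Fin (suc ⌊ d /2⌋)) →
        scale (Vec.lookup γ i) (qPow (toℕ i) ⊗ (onePlusQ ^ᴾ (d ∸ 2 ℕ.* toℕ i))))
      (List.allFin (suc ⌊ d /2⌋)))

IsGammaVector : Poly → (d : ℕ) → Vec ℤ (suc ⌊ d /2⌋) → Set
IsGammaVector h d γ = ∀ k → coeff h k ≡ coeff (gammaExpansion d γ) k

-- Matchings of the path graph P_m (vertices 1..m, edges {k,k+1}, k = 1..m-1).
-- A set of edges is encoded by its indicator list of length m ∸ 1;
-- it is a matching iff no two chosen edges share a vertex, i.e. no two
-- consecutive edges are both chosen.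

allBoolLists : ℕ → List (List Bool)
allBoolLists zero    = [] ∷ []
allBoolLists (suc k) = concatMap (λ l → (false ∷ l) ∷ (true ∷ l) ∷ []) (allBoolLists k)

noTwoAdjacent : List Bool → Bool
noTwoAdjacent []                = true
noTwoAdjacent (_ ∷ [])          = true
noTwoAdjacent (a ∷ b ∷ l)       = not (a ∧ b) ∧ noTwoAdjacent (b ∷ l)

matchings : ℕ → List (List Bool)
matchings m = filter (λ l → noTwoAdjacent l Data.Bool.≟ true) (allBoolLists (m ∸ 1))
  where import Data.Bool

edgeCount : List Bool → ℕ
edgeCount l = List.length (List.filter (λ b → b Data.Bool.≟ true) l)
  where import Data.Bool

-- all (n-1)-tuples (M_1, ..., M_{n-1}) with M_m a matching of P_m,
-- encoded as the list [M_1, ..., M_{n-1}]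
tuplesFrom : ℕ → ℕ → List (List (List Bool))
tuplesFrom m zero      = [] ∷ []
tuplesFrom m (suc k)   = concatMap (λ M → map (M ∷_) (tuplesFrom (suc m) k)) (matchings m)

matchingTuples : ℕ → List (List (List Bool))
matchingTuples n = tuplesFrom 1 (n ∸ 1)

totalEdges : List (List Bool) → ℕ
totalEdges t = sum (map edgeCount t)

tupleCount : ℕ → ℕ → ℕ
tupleCount n i = length (filter (λ t → totalEdges t Data.Nat.≟ i) (matchingTuples n))
  where import Data.Nat

signPow : ℕ → ℤ
signPow zero    = + 1
signPow (suc i) = - signPow i

claimedGamma : (n : ℕ) → Vec ℤ (suc ⌊ (n C 2) /2⌋)
claimedGamma n = Vec.tabulate (λ i → signPow (toℕ i) ℤ.* (+ tupleCount n (toℕ i)))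

module Submission where

-- Write w_d(e) = (-1)^e q^e (1+q)^(d-2e) (weight d e).  Weights are
-- multiplicative: w_{a+b}(x+y) = w_a(x) w_b(y) whenever 2x ≤ a and 2y ≤ b.
--  (1) For one path, Σ_{M matching of P_m} w_m(|M|) = [m+1] (pathSum):
--      splitting off the first edge gives the recursion
--      [m+2] = (1+q)[m+1] - q[m] satisfied by the q-integers.
--  (2) By multiplicativity the sum over tuples factors into these sums, so
--      Σ_t w_d(|t|) = [2][3]⋯[n] = [n]! with d = n choose 2.
--  (3) Grouping the tuples by their number of edges turns (2) into a
--      γ-expansion with coefficients (-1)^i |T_i| (countingGammaVector).
--  (4) γ-vectors are unique, as the q^i (1+q)^(d-2i) have distinct lowest
--      terms (qPow-independent).
-- Coefficient lists are not canonical (trailing zeros), so polynomials are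
-- compared coefficientwise; the file first develops the ring laws for this
-- equality and for finite sums.

open import Defs
open import Data.Nat using (ℕ; _≤_; ⌊_/2⌋; suc)
open import Data.Nat.Combinatorics using (_C_)
open import Data.Integer using (ℤ)
open import Data.Vec using (Vec)
open import Data.Product using (_×_)
open import Relation.Binary.PropositionalEquality using (_≡_)

open import Level using (0ℓ)
open import Data.Product using (_,_; proj₁)
open import Data.Nat using (zero; _+_; _*_; _∸_; _<_; _≡ᵇ_; z≤n; s≤s)
open import Data.Nat.Properties using (_≟_)
import Data.Nat.Properties as ℕP
open import Data.Nat.Combinatorics using (nC1≡n; nCk+nC[k+1]≡[n+1]C[k+1])
open import Data.Integer using (+_; -_) renaming (_+_ to _+ℤ_; _*_ to _*ℤ_)
import Data.Integer.Properties as ℤP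
open import Data.Integer.Tactic.RingSolver using (solve-∀)
open import Data.Bool using (Bool; true; false; _∧_; if_then_else_)
import Data.Bool as Bool
import Data.Bool.Properties as BoolP
open import Data.List using (List; []; _∷_; _++_; map; foldr; concatMap; filter; length; tabulate)
open import Data.List.Relation.Unary.All as All using (All; []; _∷_)
open import Data.List.Relation.Unary.All.Properties using (concat⁺; map⁺; all-filter; filter⁺)
open import Data.Vec as Vec using ([]; _∷_)
import Data.Vec.Properties as VecP
open import Data.Fin using (Fin; toℕ) renaming (zero to fzero; suc to fsuc)
open import Relation.Nullary.Decidable using (Dec; does)
open import Relation.Unary using (Pred; Decidable)
open import Relation.Binary.Bundles using (Setoid)
open import Algebra.Properties.AbelianGroup ℤP.+-0-abelianGroup using (∙-cancelˡ)
import Relation.Binary.Reasoning.Setoid as SetoidReasoning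
open import Relation.Binary.PropositionalEquality
  using (refl; sym; trans; cong; cong₂; subst; subst₂; module ≡-Reasoning)

infix 4 _≈_
record _≈_ (p q : Poly) : Set where
  constructor coeffwise
  field at : ∀ k → coeff p k ≡ coeff q k
open _≈_

≈-setoid : Setoid 0ℓ 0ℓ
≈-setoid = record
  { Carrier = Poly
  ; _≈_ = _≈_
  ; isEquivalence = record
    { refl = coeffwise λ _ → refl
    ; sym = λ e → coeffwise λ k → sym (at e k)
    ; trans = λ e f → coeffwise λ k → trans (at e k) (at f k)
    }
  }

open Setoid ≈-setoid using () renaming (refl to ≈-refl; sym to ≈-sym; trans to ≈-trans)
module ≈-Reasoning = SetoidReasoning ≈-setoid

≡⇒≈ : ∀ {p q} → p ≡ q → p ≈ q
≡⇒≈ refl = ≈-refl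

coeff-⊕ : ∀ p q k → coeff (p ⊕ q) k ≡ coeff p k +ℤ coeff q k
coeff-⊕ []      q       k       = sym (ℤP.+-identityˡ _)
coeff-⊕ (a ∷ p) []      k       = sym (ℤP.+-identityʳ _)
coeff-⊕ (a ∷ p) (b ∷ q) zero    = refl
coeff-⊕ (a ∷ p) (b ∷ q) (suc k) = coeff-⊕ p q k

coeff-scale : ∀ c p k → coeff (scale c p) k ≡ c *ℤ coeff p k
coeff-scale c []      k       = sym (ℤP.*-zeroʳ c)
coeff-scale c (a ∷ p) zero    = refl
coeff-scale c (a ∷ p) (suc k) = coeff-scale c p k

∷-cong : ∀ {a b p q} → a ≡ b → p ≈ q → a ∷ p ≈ b ∷ q
∷-cong a≡b p≈q = coeffwise λ { zero → a≡b ; (suc k) → at p≈q k }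

∷-zero : ∀ {p} → p ≈ [] → + 0 ∷ p ≈ []
∷-zero p≈0 = coeffwise λ { zero → refl ; (suc k) → at p≈0 k }

⊕-cong : ∀ {p p′ q q′} → p ≈ p′ → q ≈ q′ → p ⊕ q ≈ p′ ⊕ q′
⊕-cong {p} {p′} {q} {q′} e f = coeffwise λ k → begin
  coeff (p ⊕ q) k          ≡⟨ coeff-⊕ p q k ⟩
  coeff p k +ℤ coeff q k   ≡⟨ cong₂ _+ℤ_ (at e k) (at f k) ⟩
  coeff p′ k +ℤ coeff q′ k ≡⟨ coeff-⊕ p′ q′ k ⟨
  coeff (p′ ⊕ q′) k        ∎
  where open ≡-Reasoning

⊕-congˡ : ∀ {p p′} q → p ≈ p′ → p ⊕ q ≈ p′ ⊕ q
⊕-congˡ q e = ⊕-cong e (≈-refl {q})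

⊕-congʳ : ∀ p {q q′} → q ≈ q′ → p ⊕ q ≈ p ⊕ q′
⊕-congʳ p e = ⊕-cong (≈-refl {p}) e

-- Addition and scaling act coefficientwise on lists of the same shape, so
-- their laws hold as exact equalities of lists, by structural induction.

⊕-identityʳ : ∀ p → p ⊕ [] ≡ p
⊕-identityʳ []      = refl
⊕-identityʳ (a ∷ p) = refl

⊕-comm : ∀ p q → p ⊕ q ≡ q ⊕ p
⊕-comm []      q       = sym (⊕-identityʳ q)
⊕-comm (a ∷ p) []      = refl
⊕-comm (a ∷ p) (b ∷ q) = cong₂ _∷_ (ℤP.+-comm a b) (⊕-comm p q)

⊕-assoc : ∀ p q r → (p ⊕ q) ⊕ r ≡ p ⊕ (q ⊕ r)
⊕-assoc []      q       r       = refl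
⊕-assoc (a ∷ p) []      r       = refl
⊕-assoc (a ∷ p) (b ∷ q) []      = refl
⊕-assoc (a ∷ p) (b ∷ q) (c ∷ r) = cong₂ _∷_ (ℤP.+-assoc a b c) (⊕-assoc p q r)

⊕-left-comm : ∀ p q r → p ⊕ (q ⊕ r) ≡ q ⊕ (p ⊕ r)
⊕-left-comm p q r = begin
  p ⊕ (q ⊕ r) ≡⟨ ⊕-assoc p q r ⟨
  (p ⊕ q) ⊕ r ≡⟨ cong (_⊕ r) (⊕-comm p q) ⟩
  (q ⊕ p) ⊕ r ≡⟨ ⊕-assoc q p r ⟩
  q ⊕ (p ⊕ r) ∎
  where open ≡-Reasoning

⊕-interchange : ∀ p q r s → (p ⊕ q) ⊕ (r ⊕ s) ≡ (p ⊕ r) ⊕ (q ⊕ s)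
⊕-interchange p q r s = begin
  (p ⊕ q) ⊕ (r ⊕ s) ≡⟨ ⊕-assoc p q (r ⊕ s) ⟩
  p ⊕ (q ⊕ (r ⊕ s)) ≡⟨ cong (p ⊕_) (⊕-left-comm q r s) ⟩
  p ⊕ (r ⊕ (q ⊕ s)) ≡⟨ ⊕-assoc p r (q ⊕ s) ⟨
  (p ⊕ r) ⊕ (q ⊕ s) ∎
  where open ≡-Reasoning

scale-⊕ : ∀ c p q → scale c (p ⊕ q) ≡ scale c p ⊕ scale c q
scale-⊕ c []      q       = refl
scale-⊕ c (a ∷ p) []      = refl
scale-⊕ c (a ∷ p) (b ∷ q) = cong₂ _∷_ (ℤP.*-distribˡ-+ c a b) (scale-⊕ c p q)

scale-+ : ∀ a b p → scale (a +ℤ b) p ≡ scale a p ⊕ scale b p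
scale-+ a b []      = refl
scale-+ a b (c ∷ p) = cong₂ _∷_ (ℤP.*-distribʳ-+ c a b) (scale-+ a b p)

scale-scale : ∀ a b p → scale a (scale b p) ≡ scale (a *ℤ b) p
scale-scale a b []      = refl
scale-scale a b (c ∷ p) = cong₂ _∷_ (sym (ℤP.*-assoc a b c)) (scale-scale a b p)

scale-one : ∀ p → scale (+ 1) p ≡ p
scale-one []      = refl
scale-one (a ∷ p) = cong₂ _∷_ (ℤP.*-identityˡ a) (scale-one p)

-- The remaining additive facts only hold up to trailing zeros.

scale-zero : ∀ p → scale (+ 0) p ≈ []
scale-zero p = coeffwise λ k → trans (coeff-scale (+ 0) p k) (ℤP.*-zeroˡ (coeff p k))

scale-cong : ∀ c {p q} → p ≈ q → scale c p ≈ scale c q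
scale-cong c {p} {q} e =
  coeffwise λ k → trans (coeff-scale c p k) (trans (cong (c *ℤ_) (at e k)) (sym (coeff-scale c q k)))

scale-∷-zero : ∀ c p → scale c (+ 0 ∷ p) ≈ + 0 ∷ scale c p
scale-∷-zero c p = ∷-cong (ℤP.*-zeroʳ c) ≈-refl

⊕-cancelˡ : ∀ p {q r} → p ⊕ q ≈ p ⊕ r → q ≈ r
⊕-cancelˡ p {q} {r} e = coeffwise λ k →
  ∙-cancelˡ (coeff p k) (coeff q k) (coeff r k) (trans (sym (coeff-⊕ p q k)) (trans (at e k) (coeff-⊕ p r k)))

⊕-cancel : ∀ p q → (p ⊕ q) ⊕ scale (- + 1) p ≈ q
⊕-cancel p q = coeffwise λ k → begin
  coeff ((p ⊕ q) ⊕ scale (- + 1) p) k                          ≡⟨ coeff-⊕ (p ⊕ q) _ k ⟩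
  coeff (p ⊕ q) k +ℤ coeff (scale (- + 1) p) k                  ≡⟨ cong₂ _+ℤ_ (coeff-⊕ p q k) (coeff-scale (- + 1) p k) ⟩
  (coeff p k +ℤ coeff q k) +ℤ (- + 1) *ℤ coeff p k              ≡⟨ add-sub (coeff p k) (coeff q k) ⟩
  coeff q k                                                     ∎
  where
  open ≡-Reasoning
  add-sub : ∀ x y → (x +ℤ y) +ℤ (- + 1) *ℤ x ≡ y
  add-sub = solve-∀

⊗-congʳ : ∀ p {q q′} → q ≈ q′ → p ⊗ q ≈ p ⊗ q′
⊗-congʳ []      e = ≈-refl
⊗-congʳ (a ∷ p) e = ⊕-cong (scale-cong a e) (∷-cong refl (⊗-congʳ p e))

⊗-zeroʳ : ∀ p → p ⊗ [] ≈ []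
⊗-zeroʳ []      = ≈-refl
⊗-zeroʳ (a ∷ p) = ∷-zero (⊗-zeroʳ p)

⊗-∷ʳ : ∀ p b q → p ⊗ (b ∷ q) ≈ scale b p ⊕ (+ 0 ∷ p ⊗ q)
⊗-∷ʳ []      b q = coeffwise λ { zero → refl ; (suc k) → refl }
⊗-∷ʳ (a ∷ p) b q = ∷-cong (cong (_+ℤ + 0) (ℤP.*-comm a b)) (begin
  scale a q ⊕ (p ⊗ (b ∷ q))                ≈⟨ ⊕-congʳ (scale a q) (⊗-∷ʳ p b q) ⟩
  scale a q ⊕ (scale b p ⊕ (+ 0 ∷ p ⊗ q))  ≡⟨ ⊕-left-comm (scale a q) (scale b p) _ ⟩
  scale b p ⊕ (scale a q ⊕ (+ 0 ∷ p ⊗ q))  ∎)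
  where open ≈-Reasoning

⊗-comm : ∀ p q → p ⊗ q ≈ q ⊗ p
⊗-comm []      q = ≈-sym (⊗-zeroʳ q)
⊗-comm (a ∷ p) q = ≈-trans (⊕-congʳ (scale a q) (∷-cong refl (⊗-comm p q))) (≈-sym (⊗-∷ʳ q a p))

⊗-congˡ : ∀ {p p′} q → p ≈ p′ → p ⊗ q ≈ p′ ⊗ q
⊗-congˡ {p} {p′} q e = ≈-trans (⊗-comm p q) (≈-trans (⊗-congʳ q e) (⊗-comm q p′))

⊗-cong : ∀ {p p′ q q′} → p ≈ p′ → q ≈ q′ → p ⊗ q ≈ p′ ⊗ q′
⊗-cong {p′ = p′} {q = q} e f = ≈-trans (⊗-congˡ q e) (⊗-congʳ p′ f)

⊗-distribʳ : ∀ p p′ q → (p ⊕ p′) ⊗ q ≈ (p ⊗ q) ⊕ (p′ ⊗ q)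
⊗-distribʳ []      p′       q = ≈-refl
⊗-distribʳ (a ∷ p) []       q = ≡⇒≈ (sym (⊕-identityʳ _))
⊗-distribʳ (a ∷ p) (b ∷ p′) q = begin
  scale (a +ℤ b) q ⊕ (+ 0 ∷ (p ⊕ p′) ⊗ q)
    ≈⟨ ⊕-cong (≡⇒≈ (scale-+ a b q)) (∷-cong refl (⊗-distribʳ p p′ q)) ⟩
  (scale a q ⊕ scale b q) ⊕ ((+ 0 ∷ p ⊗ q) ⊕ (+ 0 ∷ p′ ⊗ q))
    ≡⟨ ⊕-interchange (scale a q) (scale b q) _ _ ⟩
  (scale a q ⊕ (+ 0 ∷ p ⊗ q)) ⊕ (scale b q ⊕ (+ 0 ∷ p′ ⊗ q))
    ∎
  where open ≈-Reasoning

⊗-distribˡ : ∀ p q q′ → p ⊗ (q ⊕ q′) ≈ (p ⊗ q) ⊕ (p ⊗ q′)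
⊗-distribˡ p q q′ = begin
  p ⊗ (q ⊕ q′)       ≈⟨ ⊗-comm p (q ⊕ q′) ⟩
  (q ⊕ q′) ⊗ p       ≈⟨ ⊗-distribʳ q q′ p ⟩
  (q ⊗ p) ⊕ (q′ ⊗ p) ≈⟨ ⊕-cong (⊗-comm q p) (⊗-comm q′ p) ⟩
  (p ⊗ q) ⊕ (p ⊗ q′) ∎
  where open ≈-Reasoning

∷-zero-⊗ : ∀ p q → (+ 0 ∷ p) ⊗ q ≈ + 0 ∷ p ⊗ q
∷-zero-⊗ p q = ⊕-congˡ (+ 0 ∷ p ⊗ q) (scale-zero q)

scale-⊗ : ∀ c p q → scale c p ⊗ q ≈ scale c (p ⊗ q)
scale-⊗ c []      q = ≈-refl
scale-⊗ c (a ∷ p) q = begin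
  scale (c *ℤ a) q ⊕ (+ 0 ∷ scale c p ⊗ q)
    ≈⟨ ⊕-cong (≡⇒≈ (sym (scale-scale c a q))) (∷-cong refl (scale-⊗ c p q)) ⟩
  scale c (scale a q) ⊕ (+ 0 ∷ scale c (p ⊗ q))
    ≈⟨ ⊕-congʳ (scale c (scale a q)) (scale-∷-zero c (p ⊗ q)) ⟨
  scale c (scale a q) ⊕ scale c (+ 0 ∷ p ⊗ q)
    ≡⟨ scale-⊕ c (scale a q) _ ⟨
  scale c (scale a q ⊕ (+ 0 ∷ p ⊗ q))
    ∎
  where open ≈-Reasoning

⊗-scale : ∀ c p q → p ⊗ scale c q ≈ scale c (p ⊗ q)
⊗-scale c p q = ≈-trans (⊗-comm p (scale c q)) (≈-trans (scale-⊗ c q p) (scale-cong c (⊗-comm q p)))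

⊗-assoc : ∀ p q r → (p ⊗ q) ⊗ r ≈ p ⊗ (q ⊗ r)
⊗-assoc []      q r = ≈-refl
⊗-assoc (a ∷ p) q r = begin
  (scale a q ⊕ (+ 0 ∷ p ⊗ q)) ⊗ r          ≈⟨ ⊗-distribʳ (scale a q) _ r ⟩
  (scale a q ⊗ r) ⊕ ((+ 0 ∷ p ⊗ q) ⊗ r)  ≈⟨ ⊕-cong (scale-⊗ a q r) (∷-zero-⊗ (p ⊗ q) r) ⟩
  scale a (q ⊗ r) ⊕ (+ 0 ∷ (p ⊗ q) ⊗ r)    ≈⟨ ⊕-congʳ (scale a (q ⊗ r)) (∷-cong refl (⊗-assoc p q r)) ⟩
  scale a (q ⊗ r) ⊕ (+ 0 ∷ p ⊗ (q ⊗ r))    ∎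
  where open ≈-Reasoning

one-⊗ : ∀ p → one ⊗ p ≈ p
one-⊗ p = ≈-trans (⊕-cong (≡⇒≈ (scale-one p)) (∷-zero ≈-refl)) (≡⇒≈ (⊕-identityʳ p))

⊗-one : ∀ p → p ⊗ one ≈ p
⊗-one p = ≈-trans (⊗-comm p one) (one-⊗ p)

⊗-interchange : ∀ p q r s → (p ⊗ q) ⊗ (r ⊗ s) ≈ (p ⊗ r) ⊗ (q ⊗ s)
⊗-interchange p q r s = begin
  (p ⊗ q) ⊗ (r ⊗ s)   ≈⟨ ⊗-assoc p q (r ⊗ s) ⟩
  p ⊗ (q ⊗ (r ⊗ s))   ≈⟨ ⊗-congʳ p (⊗-assoc q r s) ⟨
  p ⊗ ((q ⊗ r) ⊗ s)   ≈⟨ ⊗-congʳ p (⊗-congˡ s (⊗-comm q r)) ⟩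
  p ⊗ ((r ⊗ q) ⊗ s)   ≈⟨ ⊗-congʳ p (⊗-assoc r q s) ⟩
  p ⊗ (r ⊗ (q ⊗ s))   ≈⟨ ⊗-assoc p r (q ⊗ s) ⟨
  (p ⊗ r) ⊗ (q ⊗ s)   ∎
  where open ≈-Reasoning

ΣL : ∀ {A : Set} → (A → Poly) → List A → Poly
ΣL f xs = foldr _⊕_ [] (map f xs)

∑ : ∀ {N} → (Fin N → Poly) → Poly
∑ {zero}  f = []
∑ {suc N} f = f fzero ⊕ ∑ (λ i → f (fsuc i))

when : Bool → Poly → Poly
when b p = if b then p else []

when-⊗ : ∀ b c p → c ⊗ when b p ≈ when b (c ⊗ p)
when-⊗ true  c p = ≈-refl
when-⊗ false c p = ⊗-zeroʳ c

module _ {A : Set} where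

  ΣL-cong : ∀ {f g : A → Poly} xs → (∀ x → f x ≈ g x) → ΣL f xs ≈ ΣL g xs
  ΣL-cong []       e = ≈-refl
  ΣL-cong (x ∷ xs) e = ⊕-cong (e x) (ΣL-cong xs e)

  ΣL-congAll : ∀ {P : A → Set} {f g : A → Poly} {xs} →
               All P xs → (∀ x → P x → f x ≈ g x) → ΣL f xs ≈ ΣL g xs
  ΣL-congAll                []         e = ≈-refl
  ΣL-congAll {xs = x ∷ _} (px ∷ pxs) e = ⊕-cong (e x px) (ΣL-congAll pxs e)

  ΣL-zero : ∀ (xs : List A) → ΣL (λ _ → []) xs ≡ []
  ΣL-zero []       = refl
  ΣL-zero (x ∷ xs) = ΣL-zero xs

  ΣL-++ : ∀ (f : A → Poly) xs ys → ΣL f (xs ++ ys) ≡ ΣL f xs ⊕ ΣL f ys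
  ΣL-++ f []       ys = refl
  ΣL-++ f (x ∷ xs) ys = trans (cong (f x ⊕_) (ΣL-++ f xs ys)) (sym (⊕-assoc (f x) _ _))

  ΣL-⊕ : ∀ (f g : A → Poly) xs → ΣL (λ x → f x ⊕ g x) xs ≈ ΣL f xs ⊕ ΣL g xs
  ΣL-⊕ f g []       = ≈-refl
  ΣL-⊕ f g (x ∷ xs) = begin
    (f x ⊕ g x) ⊕ ΣL (λ x → f x ⊕ g x) xs  ≈⟨ ⊕-congʳ (f x ⊕ g x) (ΣL-⊕ f g xs) ⟩
    (f x ⊕ g x) ⊕ (ΣL f xs ⊕ ΣL g xs)      ≡⟨ ⊕-interchange (f x) (g x) _ _ ⟩
    (f x ⊕ ΣL f xs) ⊕ (g x ⊕ ΣL g xs)      ∎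
    where open ≈-Reasoning

  ΣL-⊗ˡ : ∀ c (f : A → Poly) xs → ΣL (λ x → c ⊗ f x) xs ≈ c ⊗ ΣL f xs
  ΣL-⊗ˡ c f []       = ≈-sym (⊗-zeroʳ c)
  ΣL-⊗ˡ c f (x ∷ xs) = ≈-trans (⊕-congʳ (c ⊗ f x) (ΣL-⊗ˡ c f xs)) (≈-sym (⊗-distribˡ c (f x) _))

  ΣL-⊗ʳ : ∀ c (f : A → Poly) xs → ΣL (λ x → f x ⊗ c) xs ≈ ΣL f xs ⊗ c
  ΣL-⊗ʳ c f xs = ≈-trans (ΣL-cong xs (λ x → ⊗-comm (f x) c)) (≈-trans (ΣL-⊗ˡ c f xs) (⊗-comm c _))

  ΣL-filter : ∀ {P : Pred A 0ℓ} (P? : Decidable P) (f : A → Poly) xs →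
              ΣL f (filter P? xs) ≡ ΣL (λ x → when (does (P? x)) (f x)) xs
  ΣL-filter P? f []       = refl
  ΣL-filter P? f (x ∷ xs) with does (P? x)
  ... | true  = cong (f x ⊕_) (ΣL-filter P? f xs)
  ... | false = ΣL-filter P? f xs

  count-scale : ∀ {P : Pred A 0ℓ} (P? : Decidable P) p xs →
                scale (+ length (filter P? xs)) p ≈ ΣL (λ x → when (does (P? x)) p) xs
  count-scale P? p []       = scale-zero p
  count-scale P? p (x ∷ xs) with does (P? x)
  ... | true  = begin
    scale (+ 1 +ℤ + length (filter P? xs)) p       ≡⟨ scale-+ (+ 1) (+ length (filter P? xs)) p ⟩
    scale (+ 1) p ⊕ scale (+ length (filter P? xs)) p ≈⟨ ⊕-cong (≡⇒≈ (scale-one p)) (count-scale P? p xs) ⟩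
    p ⊕ ΣL (λ x → when (does (P? x)) p) xs         ∎
    where open ≈-Reasoning
  ... | false = count-scale P? p xs

module _ {A B : Set} where

  ΣL-map : ∀ (f : B → Poly) (g : A → B) xs → ΣL f (map g xs) ≡ ΣL (λ x → f (g x)) xs
  ΣL-map f g []       = refl
  ΣL-map f g (x ∷ xs) = cong (f (g x) ⊕_) (ΣL-map f g xs)

  ΣL-concatMap : ∀ (f : B → Poly) (h : A → List B) xs → ΣL f (concatMap h xs) ≡ ΣL (λ x → ΣL f (h x)) xs
  ΣL-concatMap f h []       = refl
  ΣL-concatMap f h (x ∷ xs) = trans (ΣL-++ f (h x) _) (cong (ΣL f (h x) ⊕_) (ΣL-concatMap f h xs))

  ΣL-product : ∀ (f : A → Poly) (g : B → Poly) xs ys →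
               ΣL (λ x → ΣL (λ y → f x ⊗ g y) ys) xs ≈ ΣL f xs ⊗ ΣL g ys
  ΣL-product f g xs ys = ≈-trans (ΣL-cong xs (λ x → ΣL-⊗ˡ (f x) g ys)) (ΣL-⊗ʳ (ΣL g ys) f xs)

ΣL-tabulate : ∀ {B : Set} {N} (g : B → Poly) (f : Fin N → B) → ΣL g (tabulate f) ≡ ∑ (λ i → g (f i))
ΣL-tabulate {N = zero}  g f = refl
ΣL-tabulate {N = suc N} g f = cong (g (f fzero) ⊕_) (ΣL-tabulate g (λ i → f (fsuc i)))

∑-cong : ∀ {N} {f g : Fin N → Poly} → (∀ i → f i ≈ g i) → ∑ f ≈ ∑ g
∑-cong {zero}  e = ≈-refl
∑-cong {suc N} e = ⊕-cong (e fzero) (∑-cong (λ i → e (fsuc i)))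

∑-zero : ∀ N → ∑ {N} (λ _ → []) ≡ []
∑-zero zero    = refl
∑-zero (suc N) = ∑-zero N

∑-ΣL : ∀ {A : Set} N (F : Fin N → A → Poly) xs →
       ∑ (λ i → ΣL (F i) xs) ≈ ΣL (λ x → ∑ (λ i → F i x)) xs
∑-ΣL zero    F xs = ≡⇒≈ (sym (ΣL-zero xs))
∑-ΣL (suc N) F xs = begin
  ΣL (F fzero) xs ⊕ ∑ (λ i → ΣL (F (fsuc i)) xs)
    ≈⟨ ⊕-congʳ (ΣL (F fzero) xs) (∑-ΣL N (λ i → F (fsuc i)) xs) ⟩
  ΣL (F fzero) xs ⊕ ΣL (λ x → ∑ (λ i → F (fsuc i) x)) xs
    ≈⟨ ΣL-⊕ (F fzero) (λ x → ∑ (λ i → F (fsuc i) x)) xs ⟨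
  ΣL (λ x → ∑ (λ i → F i x)) xs
    ∎
  where open ≈-Reasoning

∑-indicator : ∀ {N} e (T : ℕ → Poly) → e < N → ∑ {N} (λ i → when (e ≡ᵇ toℕ i) (T (toℕ i))) ≈ T e
∑-indicator {suc N} zero    T _       = ≡⇒≈ (trans (cong (T 0 ⊕_) (∑-zero N)) (⊕-identityʳ (T 0)))
∑-indicator {suc N} (suc e) T (s≤s h) = ∑-indicator e (λ j → T (suc j)) h

∑-∷-zero : ∀ {N} (f : Fin N → Poly) → ∑ (λ i → + 0 ∷ f i) ≈ + 0 ∷ ∑ f
∑-∷-zero {zero}  f = ≈-sym (∷-zero ≈-refl)
∑-∷-zero {suc N} f = ⊕-congʳ (+ 0 ∷ f fzero) (∑-∷-zero (λ i → f (fsuc i)))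

basis : ℕ → ℕ → Poly
basis d i = qPow i ⊗ (onePlusQ ^ᴾ (d ∸ 2 * i))

-- (-1)^e q^e (1+q)^(d-2e): the contribution of a configuration of e edges
-- to the γ-expansion of a palindromic polynomial of degree d.
weight : ℕ → ℕ → Poly
weight d e = scale (signPow e) (basis d e)

negQ : Poly
negQ = scale (- + 1) (qPow 1)

signPow-+ : ∀ x y → signPow (x + y) ≡ signPow x *ℤ signPow y
signPow-+ zero    y = sym (ℤP.*-identityˡ (signPow y))
signPow-+ (suc x) y = trans (cong -_ (signPow-+ x y)) (ℤP.neg-distribˡ-* (signPow x) (signPow y))

qPow-+ : ∀ x y → qPow (x + y) ≈ qPow x ⊗ qPow y
qPow-+ zero    y = ≈-sym (one-⊗ (qPow y))
qPow-+ (suc x) y = ≈-trans (∷-cong refl (qPow-+ x y)) (≈-sym (∷-zero-⊗ (qPow x) (qPow y)))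

^ᴾ-+ : ∀ p u v → p ^ᴾ (u + v) ≈ (p ^ᴾ u) ⊗ (p ^ᴾ v)
^ᴾ-+ p zero    v = ≈-sym (one-⊗ (p ^ᴾ v))
^ᴾ-+ p (suc u) v = ≈-trans (⊗-congʳ p (^ᴾ-+ p u v)) (≈-sym (⊗-assoc p (p ^ᴾ u) (p ^ᴾ v)))

∸-split : ∀ a b x y → 2 * x ≤ a → 2 * y ≤ b → (a + b) ∸ 2 * (x + y) ≡ (a ∸ 2 * x) + (b ∸ 2 * y)
∸-split a b x y hx hy = begin
  (a + b) ∸ 2 * (x + y)         ≡⟨ cong ((a + b) ∸_) (ℕP.*-distribˡ-+ 2 x y) ⟩
  (a + b) ∸ (2 * x + 2 * y)     ≡⟨ ℕP.∸-+-assoc (a + b) (2 * x) (2 * y) ⟨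
  ((a + b) ∸ 2 * x) ∸ 2 * y     ≡⟨ cong (_∸ 2 * y) (ℕP.+-∸-comm b hx) ⟩
  ((a ∸ 2 * x) + b) ∸ 2 * y     ≡⟨ ℕP.+-∸-assoc (a ∸ 2 * x) hy ⟩
  (a ∸ 2 * x) + (b ∸ 2 * y)     ∎
  where open ≡-Reasoning

scale-⊗-scale : ∀ s t p q → scale s p ⊗ scale t q ≈ scale (s *ℤ t) (p ⊗ q)
scale-⊗-scale s t p q = begin
  scale s p ⊗ scale t q      ≈⟨ scale-⊗ s p (scale t q) ⟩
  scale s (p ⊗ scale t q)    ≈⟨ scale-cong s (⊗-scale t p q) ⟩
  scale s (scale t (p ⊗ q))  ≡⟨ scale-scale s t (p ⊗ q) ⟩
  scale (s *ℤ t) (p ⊗ q)     ∎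
  where open ≈-Reasoning

-- Weights are multiplicative: placing two configurations side by side adds
-- both their degrees and their edge numbers.
weight-+ : ∀ a b x y → 2 * x ≤ a → 2 * y ≤ b → weight (a + b) (x + y) ≈ weight a x ⊗ weight b y
weight-+ a b x y hx hy = begin
  scale (signPow (x + y)) (qPow (x + y) ⊗ (onePlusQ ^ᴾ ((a + b) ∸ 2 * (x + y))))
    ≡⟨ cong₂ (λ s n → scale s (qPow (x + y) ⊗ (onePlusQ ^ᴾ n))) (signPow-+ x y) (∸-split a b x y hx hy) ⟩
  scale (sx *ℤ sy) (qPow (x + y) ⊗ (onePlusQ ^ᴾ (a′ + b′)))
    ≈⟨ scale-cong (sx *ℤ sy) (⊗-cong (qPow-+ x y) (^ᴾ-+ onePlusQ a′ b′)) ⟩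
  scale (sx *ℤ sy) ((qPow x ⊗ qPow y) ⊗ ((onePlusQ ^ᴾ a′) ⊗ (onePlusQ ^ᴾ b′)))
    ≈⟨ scale-cong (sx *ℤ sy) (⊗-interchange (qPow x) (qPow y) _ _) ⟩
  scale (sx *ℤ sy) (basis a x ⊗ basis b y)
    ≈⟨ scale-⊗-scale sx sy (basis a x) (basis b y) ⟨
  weight a x ⊗ weight b y
    ∎
  where
  open ≈-Reasoning
  sx = signPow x
  sy = signPow y
  a′ = a ∸ 2 * x
  b′ = b ∸ 2 * y

-- Adding an unmatched vertex multiplies the weight by 1+q ...
weight-unused : ∀ k e → 2 * e ≤ suc k → weight (suc (suc k)) e ≈ onePlusQ ⊗ weight (suc k) e
weight-unused k e = weight-+ 1 (suc k) 0 e z≤n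

-- ... and adding a matched edge (two vertices, one edge) multiplies it by -q.
weight-edge : ∀ k e → 2 * e ≤ k → weight (suc (suc k)) (suc e) ≈ negQ ⊗ weight k e
weight-edge k e = weight-+ 2 k 1 e (s≤s (s≤s z≤n))

All-concatMap : ∀ {A B : Set} {P : A → Set} {Q : B → Set} {h : A → List B} {xs} →
                All P xs → (∀ x → P x → All Q (h x)) → All Q (concatMap h xs)
All-concatMap pxs k = concat⁺ (map⁺ (All.map (λ {x} px → k x px) pxs))

allBoolLists-length : ∀ k → All (λ l → length l ≡ k) (allBoolLists k)
allBoolLists-length zero    = refl ∷ []
allBoolLists-length (suc k) = All-concatMap (allBoolLists-length k) (λ l len → cong suc len ∷ cong suc len ∷ [])

ΣL-allBoolLists : ∀ k (f : List Bool → Poly) →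
                  ΣL f (allBoolLists (suc k)) ≈ ΣL (λ l → f (false ∷ l) ⊕ f (true ∷ l)) (allBoolLists k)
ΣL-allBoolLists k f = ≈-trans (≡⇒≈ (ΣL-concatMap f _ (allBoolLists k)))
  (ΣL-cong (allBoolLists k) (λ l → ≡⇒≈ (cong (f (false ∷ l) ⊕_) (⊕-identityʳ (f (true ∷ l))))))

firstEdgeFree : List Bool → Bool
firstEdgeFree (true ∷ _) = false
firstEdgeFree _          = true

noTwoAdjacent-false : ∀ l → noTwoAdjacent (false ∷ l) ≡ noTwoAdjacent l
noTwoAdjacent-false []      = refl
noTwoAdjacent-false (_ ∷ _) = refl

noTwoAdjacent-true : ∀ l → noTwoAdjacent (true ∷ l) ≡ noTwoAdjacent l ∧ firstEdgeFree l
noTwoAdjacent-true []          = refl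
noTwoAdjacent-true (true ∷ l)  = sym (BoolP.∧-zeroʳ (noTwoAdjacent (true ∷ l)))
noTwoAdjacent-true (false ∷ l) = sym (BoolP.∧-identityʳ (noTwoAdjacent (false ∷ l)))

matching-bound : ∀ l → noTwoAdjacent l ≡ true → 2 * edgeCount l ≤ suc (length l)
matching-bound []                 _     = z≤n
matching-bound (false ∷ l)        valid =
  ℕP.m≤n⇒m≤1+n (matching-bound l (trans (sym (noTwoAdjacent-false l)) valid))
matching-bound (true ∷ [])        _     = s≤s (s≤s z≤n)
matching-bound (true ∷ false ∷ l) valid =
  subst (_≤ 3 + length l) (sym (ℕP.*-suc 2 (edgeCount l)))
        (s≤s (s≤s (matching-bound l (trans (sym (noTwoAdjacent-false l)) valid))))

matchings-bound : ∀ m → All (λ M → 2 * edgeCount M ≤ m) (matchings m)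
matchings-bound zero    = z≤n ∷ []
matchings-bound (suc k) = All.zipWith
  (λ {M} (valid , len) → subst (λ n → 2 * edgeCount M ≤ suc n) len (matching-bound M valid))
  (all-filter valid? (allBoolLists k) , filter⁺ valid? (allBoolLists-length k))
  where
  valid? : (l : List Bool) → Dec (noTwoAdjacent l ≡ true)
  valid? l = noTwoAdjacent l Bool.≟ true

when-cong : ∀ b {p q} → (b ≡ true → p ≈ q) → when b p ≈ when b q
when-cong true  e = e refl
when-cong false e = ≈-refl

when-≡ : ∀ {b c} p → b ≡ c → when b p ≡ when c p
when-≡ p refl = refl

-- Σ over the matchings of the path with k + 1 vertices, and over those of
-- them leaving the first edge unused (weighted one degree lower).
matchingSum : ℕ → Poly
matchingSum k = ΣL (λ l → when (noTwoAdjacent l) (weight (suc k) (edgeCount l))) (allBoolLists k)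

freeMatchingSum : ℕ → Poly
freeMatchingSum k = ΣL (λ l → when (noTwoAdjacent l ∧ firstEdgeFree l) (weight k (edgeCount l))) (allBoolLists k)

-- Splitting off the first edge: either it is unused (factor 1+q), or it is
-- used (factor -q) and the rest is a matching leaving its first edge unused.
matchingSum-step : ∀ k → matchingSum (suc k) ≈ (onePlusQ ⊗ matchingSum k) ⊕ (negQ ⊗ freeMatchingSum k)
matchingSum-step k = begin
  matchingSum (suc k)
    ≈⟨ ΣL-allBoolLists k F ⟩
  ΣL (λ l → F (false ∷ l) ⊕ F (true ∷ l)) (allBoolLists k)
    ≈⟨ ΣL-congAll (allBoolLists-length k) (λ l len → ⊕-cong (unused l len) (used l len)) ⟩
  ΣL (λ l → (onePlusQ ⊗ a l) ⊕ (negQ ⊗ c l)) (allBoolLists k)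
    ≈⟨ ΣL-⊕ (λ l → onePlusQ ⊗ a l) (λ l → negQ ⊗ c l) (allBoolLists k) ⟩
  ΣL (λ l → onePlusQ ⊗ a l) (allBoolLists k) ⊕ ΣL (λ l → negQ ⊗ c l) (allBoolLists k)
    ≈⟨ ⊕-cong (ΣL-⊗ˡ onePlusQ a (allBoolLists k)) (ΣL-⊗ˡ negQ c (allBoolLists k)) ⟩
  (onePlusQ ⊗ matchingSum k) ⊕ (negQ ⊗ freeMatchingSum k)
    ∎
  where
  open ≈-Reasoning
  F a c : List Bool → Poly
  F l = when (noTwoAdjacent l) (weight (suc (suc k)) (edgeCount l))
  a l = when (noTwoAdjacent l) (weight (suc k) (edgeCount l))
  c l = when (noTwoAdjacent l ∧ firstEdgeFree l) (weight k (edgeCount l))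

  unused : ∀ l → length l ≡ k → F (false ∷ l) ≈ onePlusQ ⊗ a l
  unused l len = begin
    F (false ∷ l)
      ≡⟨ when-≡ _ (noTwoAdjacent-false l) ⟩
    when (noTwoAdjacent l) (weight (suc (suc k)) (edgeCount l))
      ≈⟨ when-cong (noTwoAdjacent l) (λ valid →
           weight-unused k (edgeCount l) (subst (λ n → 2 * edgeCount l ≤ suc n) len (matching-bound l valid))) ⟩
    when (noTwoAdjacent l) (onePlusQ ⊗ weight (suc k) (edgeCount l))
      ≈⟨ when-⊗ (noTwoAdjacent l) onePlusQ _ ⟨
    onePlusQ ⊗ a l
      ∎

  used : ∀ l → length l ≡ k → F (true ∷ l) ≈ negQ ⊗ c l
  used l len = begin
    F (true ∷ l)
      ≈⟨ when-cong (noTwoAdjacent (true ∷ l)) (λ valid → weight-edge k (edgeCount l) (bound valid)) ⟩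
    when (noTwoAdjacent (true ∷ l)) (negQ ⊗ weight k (edgeCount l))
      ≡⟨ when-≡ _ (noTwoAdjacent-true l) ⟩
    when (noTwoAdjacent l ∧ firstEdgeFree l) (negQ ⊗ weight k (edgeCount l))
      ≈⟨ when-⊗ (noTwoAdjacent l ∧ firstEdgeFree l) negQ _ ⟨
    negQ ⊗ c l
      ∎
    where
    bound : noTwoAdjacent (true ∷ l) ≡ true → 2 * edgeCount l ≤ k
    bound valid = ℕP.+-cancelˡ-≤ 2 _ _
      (subst₂ _≤_ (ℕP.*-suc 2 (edgeCount l)) (cong (λ n → 2 + n) len) (matching-bound (true ∷ l) valid))

-- Leaving the first edge unused is the same as deleting the first vertex.
freeMatchingSum-step : ∀ k → freeMatchingSum (suc k) ≈ matchingSum k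
freeMatchingSum-step k = ≈-trans (ΣL-allBoolLists k G) (ΣL-cong (allBoolLists k) (λ l → ≡⇒≈ (split l)))
  where
  G : List Bool → Poly
  G l = when (noTwoAdjacent l ∧ firstEdgeFree l) (weight (suc k) (edgeCount l))
  split : ∀ l → G (false ∷ l) ⊕ G (true ∷ l) ≡ when (noTwoAdjacent l) (weight (suc k) (edgeCount l))
  split l = begin
    G (false ∷ l) ⊕ G (true ∷ l)
      ≡⟨ cong₂ _⊕_ (when-≡ _ (trans (BoolP.∧-identityʳ _) (noTwoAdjacent-false l)))
                   (when-≡ _ (BoolP.∧-zeroʳ (noTwoAdjacent (true ∷ l)))) ⟩
    when (noTwoAdjacent l) (weight (suc k) (edgeCount l)) ⊕ []
      ≡⟨ ⊕-identityʳ _ ⟩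
    when (noTwoAdjacent l) (weight (suc k) (edgeCount l))
      ∎
    where open ≡-Reasoning

-- The q-integers satisfy the same recursion: [m+2] = (1+q)[m+1] - q[m].
qInt-step : ∀ m → qInt (suc (suc m)) ≈ (onePlusQ ⊗ qInt (suc m)) ⊕ (negQ ⊗ qInt m)
qInt-step m = ≈-sym (begin
  (onePlusQ ⊗ qInt (suc m)) ⊕ (negQ ⊗ qInt m)
    ≈⟨ ⊕-cong (onePlusQ-⊗ (qInt (suc m))) (negQ-⊗ (qInt m)) ⟩
  (qInt (suc m) ⊕ (+ 0 ∷ qInt (suc m))) ⊕ (+ 0 ∷ scale (- + 1) (qInt m))
    ≈⟨ ∷-cong refl (⊕-cancel (qInt m) (qInt (suc m))) ⟩
  qInt (suc (suc m))
    ∎)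
  where
  open ≈-Reasoning
  onePlusQ-⊗ : ∀ p → onePlusQ ⊗ p ≈ p ⊕ (+ 0 ∷ p)
  onePlusQ-⊗ p = ⊕-cong (≡⇒≈ (scale-one p)) (∷-cong refl (one-⊗ p))
  negQ-⊗ : ∀ p → negQ ⊗ p ≈ + 0 ∷ scale (- + 1) p
  negQ-⊗ p = ⊕-cong (scale-zero p) (∷-cong refl (≈-trans (⊕-congʳ (scale (- + 1) p) (∷-zero ≈-refl))
                                                          (≡⇒≈ (⊕-identityʳ _))))

matchingSums : ∀ k → (matchingSum k ≈ qInt (suc (suc k))) × (freeMatchingSum k ≈ qInt (suc k))
matchingSums zero    = ≈-refl , ≈-refl
matchingSums (suc k) with matchingSums k
... | sum≈ , free≈ =
  ≈-trans (matchingSum-step k)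
    (≈-trans (⊕-cong (⊗-congʳ onePlusQ sum≈) (⊗-congʳ negQ free≈)) (≈-sym (qInt-step (suc k)))) ,
  ≈-trans (freeMatchingSum-step k) sum≈

pathSum : ∀ m → ΣL (λ M → weight m (edgeCount M)) (matchings m) ≈ qInt (suc m)
pathSum zero    = ≈-refl
pathSum (suc k) = begin
  ΣL (λ M → weight (suc k) (edgeCount M)) (matchings (suc k))
    ≡⟨ ΣL-filter (λ l → noTwoAdjacent l Bool.≟ true) _ (allBoolLists k) ⟩
  ΣL (λ l → when (does (noTwoAdjacent l Bool.≟ true)) (weight (suc k) (edgeCount l))) (allBoolLists k)
    ≈⟨ ΣL-cong (allBoolLists k) (λ l → ≡⇒≈ (when-≡ _ (does-≟-true (noTwoAdjacent l)))) ⟩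
  matchingSum k
    ≈⟨ proj₁ (matchingSums k) ⟩
  qInt (suc (suc k))
    ∎
  where
  open ≈-Reasoning
  does-≟-true : ∀ b → does (b Bool.≟ true) ≡ b
  does-≟-true true  = refl
  does-≟-true false = refl

-- Σ_{j<k} (m + j), the degree of [m+1][m+2]⋯[m+k].
degreeSum : ℕ → ℕ → ℕ
degreeSum m zero    = 0
degreeSum m (suc k) = m + degreeSum (suc m) k

-- Pascal's rule, summed: (m+k choose 2) - (m choose 2) = m + (m+1) + ⋯ + (m+k-1).
degreeSum-C2 : ∀ m k → degreeSum m k + m C 2 ≡ (m + k) C 2
degreeSum-C2 m zero    = cong (_C 2) (sym (ℕP.+-identityʳ m))
degreeSum-C2 m (suc k) = begin
  (m + D) + m C 2        ≡⟨ cong (_+ m C 2) (ℕP.+-comm m D) ⟩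
  (D + m) + m C 2        ≡⟨ ℕP.+-assoc D m (m C 2) ⟩
  D + (m + m C 2)        ≡⟨ cong (λ x → D + (x + m C 2)) (nC1≡n m) ⟨
  D + (m C 1 + m C 2)    ≡⟨ cong (λ x → D + x) (nCk+nC[k+1]≡[n+1]C[k+1] m 1) ⟩
  D + suc m C 2          ≡⟨ degreeSum-C2 (suc m) k ⟩
  (suc m + k) C 2        ≡⟨ cong (_C 2) (ℕP.+-suc m k) ⟨
  (m + suc k) C 2        ∎
  where
  open ≡-Reasoning
  D = degreeSum (suc m) k

degreeSum-1 : ∀ n′ → degreeSum 1 n′ ≡ suc n′ C 2
degreeSum-1 n′ = trans (sym (ℕP.+-identityʳ (degreeSum 1 n′))) (degreeSum-C2 1 n′)

tuples-bound : ∀ m k → All (λ t → 2 * totalEdges t ≤ degreeSum m k) (tuplesFrom m k)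
tuples-bound m zero    = z≤n ∷ []
tuples-bound m (suc k) = All-concatMap (matchings-bound m) λ M M-bound →
  map⁺ (All.map (λ {t} t-bound →
    subst (_≤ m + degreeSum (suc m) k) (sym (ℕP.*-distribˡ-+ 2 (edgeCount M) (totalEdges t)))
          (ℕP.+-mono-≤ M-bound t-bound))
    (tuples-bound (suc m) k))

tupleSum : ℕ → ℕ → Poly
tupleSum m k = ΣL (λ t → weight (degreeSum m k) (totalEdges t)) (tuplesFrom m k)

-- The sum over tuples factorizes, by multiplicativity of weights, into the
-- sum over the matchings of the first path times the sum over the rest.
tupleSum-step : ∀ m k → tupleSum m (suc k) ≈ qInt (suc m) ⊗ tupleSum (suc m) k
tupleSum-step m k = begin
  tupleSum m (suc k)
    ≡⟨ ΣL-concatMap f (λ M → map (M ∷_) ts) ms ⟩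
  ΣL (λ M → ΣL f (map (M ∷_) ts)) ms
    ≈⟨ ΣL-cong ms (λ M → ≡⇒≈ (ΣL-map f (M ∷_) ts)) ⟩
  ΣL (λ M → ΣL (λ t → f (M ∷ t)) ts) ms
    ≈⟨ ΣL-congAll (matchings-bound m) (λ M M-bound → ΣL-congAll (tuples-bound (suc m) k) (λ t t-bound →
         weight-+ m D (edgeCount M) (totalEdges t) M-bound t-bound)) ⟩
  ΣL (λ M → ΣL (λ t → weight m (edgeCount M) ⊗ weight D (totalEdges t)) ts) ms
    ≈⟨ ΣL-product (λ M → weight m (edgeCount M)) (λ t → weight D (totalEdges t)) ms ts ⟩
  ΣL (λ M → weight m (edgeCount M)) ms ⊗ tupleSum (suc m) k
    ≈⟨ ⊗-congˡ (tupleSum (suc m) k) (pathSum m) ⟩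
  qInt (suc m) ⊗ tupleSum (suc m) k
    ∎
  where
  open ≈-Reasoning
  D = degreeSum (suc m) k
  ms = matchings m
  ts = tuplesFrom (suc m) k
  f : List (List Bool) → Poly
  f t = weight (m + D) (totalEdges t)

tupleSum-qFact : ∀ m k → qFact m ⊗ tupleSum m k ≈ qFact (m + k)
tupleSum-qFact m zero    = ≈-trans (⊗-one (qFact m)) (≡⇒≈ (cong qFact (sym (ℕP.+-identityʳ m))))
tupleSum-qFact m (suc k) = begin
  qFact m ⊗ tupleSum m (suc k)                    ≈⟨ ⊗-congʳ (qFact m) (tupleSum-step m k) ⟩
  qFact m ⊗ (qInt (suc m) ⊗ tupleSum (suc m) k)   ≈⟨ ⊗-assoc (qFact m) (qInt (suc m)) _ ⟨
  (qFact m ⊗ qInt (suc m)) ⊗ tupleSum (suc m) k   ≈⟨ ⊗-congˡ (tupleSum (suc m) k) (⊗-comm (qFact m) _) ⟩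
  qFact (suc m) ⊗ tupleSum (suc m) k              ≈⟨ tupleSum-qFact (suc m) k ⟩
  qFact (suc m + k)                               ≡⟨ cong qFact (ℕP.+-suc m k) ⟨
  qFact (m + suc k)                               ∎
  where open ≈-Reasoning

matchingTuples-sum : ∀ n′ →
  ΣL (λ t → weight (suc n′ C 2) (totalEdges t)) (matchingTuples (suc n′)) ≈ qFact (suc n′)
matchingTuples-sum n′ =
  subst (λ d → ΣL (λ t → weight d (totalEdges t)) (tuplesFrom 1 n′) ≈ qFact (suc n′)) (degreeSum-1 n′)
        (≈-trans (≈-sym (one-⊗ (tupleSum 1 n′))) (tupleSum-qFact 1 n′))

matchingTuples-bound : ∀ n′ → All (λ t → 2 * totalEdges t ≤ suc n′ C 2) (matchingTuples (suc n′))
matchingTuples-bound n′ =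
  subst (λ d → All (λ t → 2 * totalEdges t ≤ d) (tuplesFrom 1 n′)) (degreeSum-1 n′) (tuples-bound 1 n′)

gammaExpansion-∑ : ∀ d (γ : Vec ℤ (suc ⌊ d /2⌋)) →
                   gammaExpansion d γ ≡ ∑ (λ i → scale (Vec.lookup γ i) (basis d (toℕ i)))
gammaExpansion-∑ d γ = ΣL-tabulate (λ i → scale (Vec.lookup γ i) (basis d (toℕ i))) (λ i → i)

half-bound : ∀ e d → 2 * e ≤ d → e < suc ⌊ d /2⌋
half-bound e d 2e≤d = s≤s (subst (_≤ ⌊ d /2⌋) (sym (ℕP.n≡⌊n+n/2⌋ e))
  (ℕP.⌊n/2⌋-mono (subst (_≤ d) (cong (λ x → e + x) (ℕP.+-identityʳ e)) 2e≤d)))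

signedCount : ∀ {A : Set} → (A → ℕ) → List A → ℕ → ℤ
signedCount e X i = signPow i *ℤ + length (filter (λ x → e x ≟ i) X)

countingGammaVector : ∀ {A : Set} d (e : A → ℕ) X h →
  All (λ x → 2 * e x ≤ d) X → ΣL (λ x → weight d (e x)) X ≈ h →
  IsGammaVector h d (Vec.tabulate (λ i → signedCount e X (toℕ i)))
countingGammaVector {A} d e X h bounds sum≈h = at (begin
  h
    ≈⟨ sum≈h ⟨
  ΣL (λ x → weight d (e x)) X
    ≈⟨ ΣL-congAll bounds (λ x bound → ∑-indicator (e x) (weight d) (half-bound (e x) d bound)) ⟨
  ΣL (λ x → ∑ (λ i → T i x)) X
    ≈⟨ ∑-ΣL (suc ⌊ d /2⌋) T X ⟨
  ∑ (λ i → ΣL (T i) X)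
    ≈⟨ ∑-cong {f = counted} (λ i → count-scale (λ x → e x ≟ toℕ i) (weight d (toℕ i)) X) ⟨
  ∑ counted
    ≈⟨ ∑-cong {f = counted} {g = term} (λ i → ≡⇒≈ (signed i)) ⟩
  ∑ term
    ≡⟨ gammaExpansion-∑ d γ ⟨
  gammaExpansion d γ
    ∎)
  where
  open ≈-Reasoning
  γ : Vec ℤ (suc ⌊ d /2⌋)
  γ = Vec.tabulate (λ i → signedCount e X (toℕ i))
  count : ℕ → ℕ
  count i = length (filter (λ x → e x ≟ i) X)
  T : Fin (suc ⌊ d /2⌋) → A → Poly
  T i x = when (e x ≡ᵇ toℕ i) (weight d (toℕ i))
  counted term : Fin (suc ⌊ d /2⌋) → Poly
  counted i = scale (+ count (toℕ i)) (weight d (toℕ i))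
  term i = scale (Vec.lookup γ i) (basis d (toℕ i))
  signed : ∀ i → counted i ≡ term i
  signed i = trans (scale-scale (+ count (toℕ i)) (signPow (toℕ i)) (basis d (toℕ i)))
    (cong (λ c → scale c (basis d (toℕ i)))
          (trans (ℤP.*-comm (+ count (toℕ i)) (signPow (toℕ i))) (sym (VecP.lookup∘tabulate (λ j → signedCount e X (toℕ j)) i))))

onePlusQ^-coeff-0 : ∀ u → coeff (onePlusQ ^ᴾ u) 0 ≡ + 1
onePlusQ^-coeff-0 zero    = refl
onePlusQ^-coeff-0 (suc u) = begin
  coeff (onePlusQ ⊗ P) 0                        ≡⟨ coeff-⊕ (scale (+ 1) P) _ 0 ⟩
  coeff (scale (+ 1) P) 0 +ℤ + 0                ≡⟨ ℤP.+-identityʳ _ ⟩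
  coeff (scale (+ 1) P) 0                       ≡⟨ cong (λ p → coeff p 0) (scale-one P) ⟩
  coeff P 0                                     ≡⟨ onePlusQ^-coeff-0 u ⟩
  + 1                                           ∎
  where
  open ≡-Reasoning
  P = onePlusQ ^ᴾ u

-- Polynomials q^i U_i whose factors U_i have constant term 1 are linearly
-- independent: compare constant terms, cancel, divide by q and recurse.
qPow-independent : ∀ {N} (γ γ′ : Vec ℤ N) (U : Fin N → Poly) → (∀ i → coeff (U i) 0 ≡ + 1) →
  ∑ (λ i → scale (Vec.lookup γ i) (qPow (toℕ i) ⊗ U i)) ≈ ∑ (λ i → scale (Vec.lookup γ′ i) (qPow (toℕ i) ⊗ U i)) →
  γ ≡ γ′
qPow-independent []      []        U U-const e = refl
qPow-independent {suc N} (x ∷ γ) (y ∷ γ′) U U-const e =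
  cong₂ _∷_ x≡y (qPow-independent γ γ′ (λ i → U (fsuc i)) (λ i → U-const (fsuc i)) tails≈)
  where
  S S′ : Vec ℤ N → Poly
  S  c = ∑ (λ i → scale (Vec.lookup c i) (qPow (suc (toℕ i)) ⊗ U (fsuc i)))
  S′ c = ∑ (λ i → scale (Vec.lookup c i) (qPow (toℕ i) ⊗ U (fsuc i)))

  S≈qS′ : ∀ c → S c ≈ + 0 ∷ S′ c
  S≈qS′ c = ≈-trans
    (∑-cong {g = λ i → + 0 ∷ scale (Vec.lookup c i) (qPow (toℕ i) ⊗ U (fsuc i))} (λ i → ≈-trans (scale-cong (Vec.lookup c i) (∷-zero-⊗ (qPow (toℕ i)) (U (fsuc i))))
                             (scale-∷-zero (Vec.lookup c i) _)))
    (∑-∷-zero (λ i → scale (Vec.lookup c i) (qPow (toℕ i) ⊗ U (fsuc i))))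

  split : ∀ z c → scale z (one ⊗ U fzero) ⊕ S c ≈ scale z (U fzero) ⊕ (+ 0 ∷ S′ c)
  split z c = ⊕-cong (scale-cong z (one-⊗ (U fzero))) (S≈qS′ c)

  e′ : scale x (U fzero) ⊕ (+ 0 ∷ S′ γ) ≈ scale y (U fzero) ⊕ (+ 0 ∷ S′ γ′)
  e′ = ≈-trans (≈-sym (split x γ)) (≈-trans e (split y γ′))

  constant-term : ∀ z r → coeff (scale z (U fzero) ⊕ (+ 0 ∷ r)) 0 ≡ z
  constant-term z r = begin
    coeff (scale z (U fzero) ⊕ (+ 0 ∷ r)) 0  ≡⟨ coeff-⊕ (scale z (U fzero)) _ 0 ⟩
    coeff (scale z (U fzero)) 0 +ℤ + 0       ≡⟨ ℤP.+-identityʳ _ ⟩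
    coeff (scale z (U fzero)) 0              ≡⟨ coeff-scale z (U fzero) 0 ⟩
    z *ℤ coeff (U fzero) 0                   ≡⟨ cong (z *ℤ_) (U-const fzero) ⟩
    z *ℤ + 1                                 ≡⟨ ℤP.*-identityʳ z ⟩
    z                                        ∎
    where open ≡-Reasoning

  x≡y : x ≡ y
  x≡y = trans (sym (constant-term x _)) (trans (at e′ 0) (constant-term y _))

  tails≈ : S′ γ ≈ S′ γ′
  tails≈ = coeffwise λ k →
    at (⊕-cancelˡ (scale x (U fzero)) (subst (λ z → scale x (U fzero) ⊕ (+ 0 ∷ S′ γ) ≈ scale z (U fzero) ⊕ (+ 0 ∷ S′ γ′)) (sym x≡y) e′)) (suc k)

gammaVector-unique : ∀ h d (γ γ′ : Vec ℤ (suc ⌊ d /2⌋)) → IsGammaVector h d γ → IsGammaVector h d γ′ → γ ≡ γ′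
gammaVector-unique h d γ γ′ isγ isγ′ =
  qPow-independent γ γ′ (λ i → onePlusQ ^ᴾ (d ∸ 2 * toℕ i)) (λ i → onePlusQ^-coeff-0 (d ∸ 2 * toℕ i)) (begin
    ∑ (λ i → scale (Vec.lookup γ i) (basis d (toℕ i)))    ≡⟨ gammaExpansion-∑ d γ ⟨
    gammaExpansion d γ                                    ≈⟨ coeffwise isγ ⟨
    h                                                     ≈⟨ coeffwise isγ′ ⟩
    gammaExpansion d γ′                                   ≡⟨ gammaExpansion-∑ d γ′ ⟩
    ∑ (λ i → scale (Vec.lookup γ′ i) (basis d (toℕ i)))   ∎)
  where open ≈-Reasoning

corollary3p2 : (n : ℕ) → 1 ≤ n →
    IsGammaVector (qFact n) (n C 2) (claimedGamma n)
    × ((γ : Vec ℤ (suc ⌊ (n C 2) /2⌋)) → IsGammaVector (qFact n) (n C 2) γ → γ ≡ claimedGamma n)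
corollary3p2 (suc n′) _ = expansion , λ γ isγ → gammaVector-unique (qFact n) (n C 2) γ (claimedGamma n) isγ expansion
  where
  n = suc n′
  expansion : IsGammaVector (qFact n) (n C 2) (claimedGamma n)
  expansion = countingGammaVector (n C 2) totalEdges (matchingTuples n) (qFact n)
    (matchingTuples-bound n′) (matchingTuples-sum n′)
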